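{- Let $G$ be a graph and $(H,(G_h)_{h\in H})$ a point-finite and honest graph-decomposition of $G$ into finite connected parts. Then the map $f\mapsto g_f$ from the directions of $G$ to the directions of $H$ is a bijection.
   Context: A graph-decomposition of $G$ is a pair $(H,(G_h)_{h\in H})$ of a graph $H$ and subgraphs $G_h\subseteq G$ with $\bigcup_hG_h=G$ such that for every vertex $v$ of $G$ the subgraph $H_v$ of $H$ induced by $\{h:v\in G_h\}$ is connected. It is honest if $G_h\cap G_{h'}\ne\emptyset$ for every edge $hh'$ of $H$, and point-finite if every $H_v$ is finite. A direction of a graph $G$ is a map $f$ assigning to every finite $X\subseteq V(G)$ a component $f(X)$ of $G-X$ such that $f(X)\supseteq f(X')$ whenever $X\subseteq X'$. For a direction $f$ of $G$ and finite $Y\subseteq V(H)$, set $X_Y=\bigcup_{h\in Y}V(G_h)$ (finite); then $\bigcup_{v\in f(X_Y)}H_v$ lies in a single component of $H-Y$, and $g_f(Y)$ is defined to be this component; $g_f$ is a direction of $H$. -}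

module Defs where

open import Data.List using (List; concatMap)
open import Data.List.Membership.Propositional using (_∈_)
open import Data.Product using (Σ; ∃; _×_; proj₁)
open import Relation.Nullary using (¬_)
open import Relation.Binary.PropositionalEquality using (_≡_)
open import Function.Bundles using (_⇔_)

record Graph : Set₁ where
  field
    V    : Set
    _~_  : V → V → Set
    sym~ : ∀ {u w} → u ~ w → w ~ u
    irr~ : ∀ {u} → ¬ (u ~ u)
open Graph public

data Walk {A : Set} (E : A → A → Set) (P : A → Set) : A → A → Set where
  stop : ∀ {u} → P u → Walk E P u u
  step : ∀ {u w z} → P u → E u w → Walk E P w z → Walk E P u z

-- Vertex set of a component of G - X, where X is a finite vertex set (a list).
-- A component is a maximal connected (nonempty) subgraph; being induced, it is
-- determined by its vertex set.
IsComponent : (G : Graph) → List (V G) → (V G → Set) → Set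
IsComponent G X C =
    (∃ λ v → C v)
  × (∀ v → C v → ¬ (v ∈ X))
  × (∀ u w → C u → C w → Walk (_~_ G) (λ x → ¬ (x ∈ X)) u w)
  × (∀ u w → C u → _~_ G u w → ¬ (w ∈ X) → C w)

_⊆L_ : {A : Set} → List A → List A → Set
X ⊆L Y = ∀ x → x ∈ X → x ∈ Y

IsDirection : (G : Graph) → (List (V G) → V G → Set) → Set
IsDirection G f =
    (∀ X → IsComponent G X (f X))
  × (∀ X X' → X ⊆L X' → ∀ v → f X' v → f X v)

_≈Dir_ : {G : Graph} → (List (V G) → V G → Set) → (List (V G) → V G → Set) → Set
_≈Dir_ {G} f f' = ∀ X v → f X v ⇔ f' X v

record Decomposition (G : Graph) : Set₁ where
  field
    H     : Graph
    PV    : V H → V G → Set              -- vertices of G_h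
    PE    : V H → V G → V G → Set        -- edges of G_h
    PE-ok : ∀ h u w → PE h u w → _~_ G u w × PV h u × PV h w
    coverV : ∀ v → ∃ λ h → PV h v
    coverE : ∀ u w → _~_ G u w → ∃ λ h → PE h u w
    Hv-conn : ∀ v h h' → PV h v → PV h' v → Walk (_~_ H) (λ k → PV k v) h h'
open Decomposition public

IsHonest : {G : Graph} → Decomposition G → Set
IsHonest {G} D = ∀ h h' → _~_ (H D) h h' → ∃ λ v → PV D h v × PV D h' v

IsPointFinite : {G : Graph} → Decomposition G → Set
IsPointFinite {G} D = ∀ v → Σ (List (V (H D))) λ L → ∀ h → PV D h v ⇔ (h ∈ L)

FiniteParts : {G : Graph} → Decomposition G → Set
FiniteParts {G} D = ∀ h → Σ (List (V G)) λ L → ∀ v → PV D h v ⇔ (v ∈ L)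

ConnectedParts : {G : Graph} → Decomposition G → Set
ConnectedParts {G} D = ∀ h →
  (∃ λ v → PV D h v) × (∀ u w → PV D h u → PV D h w → Walk (PE D h) (PV D h) u w)

X[_,_,_] : {G : Graph} (D : Decomposition G) → FiniteParts D → List (V (H D)) → List (V G)
X[ D , fin , Y ] = concatMap (λ h → proj₁ (fin h)) Y

-- "g = g_f": for every finite Y ⊆ V(H), g(Y) is the component of H - Y containing
-- ⋃_{v ∈ f(X_Y)} H_v.
IsInducedDir : {G : Graph} (D : Decomposition G) (fin : FiniteParts D) →
  (List (V G) → V G → Set) → (List (V (H D)) → V (H D) → Set) → Set
IsInducedDir D fin f g = ∀ Y v h → f X[ D , fin , Y ] v → PV D h v → g Y h

{-# OPTIONS --safe #-}
module Submission where

open import Defs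
open import Data.List using (List; concatMap)
open import Data.List.Membership.Propositional using (_∈_; _∉_; lose; find)
open import Data.List.Membership.Propositional.Properties using (∈-concatMap⁺; ∈-concatMap⁻)
open import Data.Product using (Σ; ∃; _×_; _,_; proj₁; proj₂)
open import Function using (id; flip)
open import Function.Bundles using (_⇔_; mk⇔; Equivalence)

-- Read the decomposition as the relation "v ∈ G_h" between V(G) and V(H). Both it
-- and its converse send each vertex to a finite, nonempty, connected set and adjacent
-- vertices to touching sets, so walks avoiding a finite set transfer in both
-- directions. Hence g_f(Y), the component of H - Y met by the parts at f(X_Y), is
-- well defined, and if f induces g along the relation then g induces f along the
-- converse: injectivity is then uniqueness of induced directions for the converse,
-- and surjectivity is the construction of g_f applied to the converse.

module _ {A : Set} {E : A → A → Set} where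

  Walk-head : ∀ {P : A → Set} {u w} → Walk E P u w → P u
  Walk-head (stop p)     = p
  Walk-head (step p _ _) = p

  Walk-last : ∀ {P : A → Set} {u w} → Walk E P u w → P w
  Walk-last (stop p)     = p
  Walk-last (step _ _ W) = Walk-last W

  _++ᵂ_ : ∀ {P : A → Set} {u w z} → Walk E P u w → Walk E P w z → Walk E P u z
  stop _     ++ᵂ W' = W'
  step p e W ++ᵂ W' = step p e (W ++ᵂ W')

  Walk-snoc : ∀ {P : A → Set} {u w z} → Walk E P u w → E w z → P z → Walk E P u z
  Walk-snoc W e pz = W ++ᵂ step (Walk-last W) e (stop pz)

  Walk-reverse : ∀ {P : A → Set} → (∀ {x y} → E x y → E y x) →
    ∀ {u w} → Walk E P u w → Walk E P w u
  Walk-reverse s (stop p)     = stop p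
  Walk-reverse s (step p e W) = Walk-snoc (Walk-reverse s W) (s e) p

Walk-map : {A : Set} {E E' : A → A → Set} {P Q : A → Set} →
  (∀ {x} → P x → Q x) → (∀ {x y} → E x y → E' x y) →
  ∀ {u w} → Walk E P u w → Walk E' Q u w
Walk-map f g (stop p)     = stop (f p)
Walk-map f g (step p e W) = step (f p) (g e) (Walk-map f g W)

module Component {K : Graph} {X : List (V K)} {C : V K → Set} (c : IsComponent K X C) where

  nonempty : ∃ C
  nonempty = proj₁ c

  avoids : ∀ v → C v → v ∉ X
  avoids = proj₁ (proj₂ c)

  connected : ∀ u w → C u → C w → Walk (_~_ K) (_∉ X) u w
  connected = proj₁ (proj₂ (proj₂ c))

  closed : ∀ u w → C u → _~_ K u w → w ∉ X → C w
  closed = proj₂ (proj₂ (proj₂ c))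

  closed-walk : ∀ {u w} → C u → Walk (_~_ K) (_∉ X) u w → C w
  closed-walk cu (stop _)     = cu
  closed-walk cu (step _ e W) = closed-walk (closed _ _ cu e (Walk-head W)) W

component-unique : {K : Graph} {X : List (V K)} {C C' : V K → Set} →
  IsComponent K X C → IsComponent K X C' → ∀ {a} → C a → C' a → ∀ v → C v ⇔ C' v
component-unique {K} {X} {C} {C'} c c' ca c'a v =
  mk⇔ (λ cv → C'.closed-walk c'a (C.connected _ _ ca cv))
      (λ cv → C.closed-walk ca (C'.connected _ _ c'a cv))
  where
    module C  = Component {K} {X} {C} c
    module C' = Component {K} {X} {C'} c'

module Direction {K : Graph} {f : List (V K) → V K → Set} (df : IsDirection K f) where

  antitone : ∀ {X X'} → X ⊆L X' → ∀ {v} → f X' v → f X v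
  antitone s = proj₂ df _ _ s _

  module Part (X : List (V K)) = Component {K} {X} {f X} (proj₁ df X)

record IsConnectedRelation (K L : Graph) (R : V K → V L → Set) : Set where
  field
    finite-preimage : ∀ h → Σ (List (V K)) λ vs → ∀ v → R v h ⇔ v ∈ vs
    total           : ∀ v → ∃ (R v)
    image-connected : ∀ v {h h'} → R v h → R v h' → Walk (_~_ L) (R v) h h'
    edge-linked     : ∀ {u w} → _~_ K u w → ∃ λ h → R u h × R w h

module ConnectedRelation {K L : Graph} {R : V K → V L → Set} (c : IsConnectedRelation K L R) where
  open IsConnectedRelation c

  preimage : List (V L) → List (V K)
  preimage Y = concatMap (λ h → proj₁ (finite-preimage h)) Y

  ∈-preimage⁺ : ∀ {Y v h} → h ∈ Y → R v h → v ∈ preimage Y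
  ∈-preimage⁺ {h = h} h∈Y r =
    ∈-concatMap⁺ (λ h → proj₁ (finite-preimage h))
      (lose h∈Y (Equivalence.to (proj₂ (finite-preimage h) _) r))

  ∈-preimage⁻ : ∀ {Y v} → v ∈ preimage Y → ∃ λ h → h ∈ Y × R v h
  ∈-preimage⁻ {Y} v∈ with find (∈-concatMap⁻ (λ h → proj₁ (finite-preimage h)) {xs = Y} v∈)
  ... | h , h∈Y , v∈h = h , h∈Y , Equivalence.from (proj₂ (finite-preimage h) _) v∈h

  preimage-mono : ∀ {Y Y'} → Y ⊆L Y' → preimage Y ⊆L preimage Y'
  preimage-mono s v v∈ with ∈-preimage⁻ v∈
  ... | h , h∈Y , r = ∈-preimage⁺ (s h h∈Y) r

  ∉-preimage : ∀ {Y v h} → v ∉ preimage Y → R v h → h ∉ Y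
  ∉-preimage v∉ r h∈Y = v∉ (∈-preimage⁺ h∈Y r)

  transfer-walk : ∀ {P : V K → Set} {Q : V L → Set} → (∀ {v h} → P v → R v h → Q h) →
    ∀ {u w h h'} → Walk (_~_ K) P u w → R u h → R w h' → Walk (_~_ L) Q h h'
  transfer-walk PQ (stop p) r r' = Walk-map (PQ p) id (image-connected _ r r')
  transfer-walk PQ (step p e W) r r' with edge-linked e
  ... | k , ru , rw = Walk-map (PQ p) id (image-connected _ r ru) ++ᵂ transfer-walk PQ W rw r'

  Induces : (List (V K) → V K → Set) → (List (V L) → V L → Set) → Set
  Induces f g = ∀ Y v h → f (preimage Y) v → R v h → g Y h

  push : (List (V K) → V K → Set) → List (V L) → V L → Set
  push f Y h = ∃ λ v → ∃ λ h' → f (preimage Y) v × R v h' × Walk (_~_ L) (_∉ Y) h' h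

  module _ {f : List (V K) → V K → Set} (df : IsDirection K f) where
    open Direction {K} {f} df

    push-induces : Induces f (push f)
    push-induces Y v h fv r =
      v , h , fv , r , stop (∉-preimage (Part.avoids (preimage Y) v fv) r)

    push-component : ∀ Y → IsComponent L Y (push f Y)
    push-component Y = nonempty , avoids , connected , closed
      where
        module C = Part (preimage Y)

        nonempty : ∃ (push f Y)
        nonempty with C.nonempty
        ... | v , fv with total v
        ... | h , r = h , push-induces Y v h fv r

        avoids : ∀ h → push f Y h → h ∉ Y
        avoids h (_ , _ , _ , _ , W) = Walk-last W

        connected : ∀ u w → push f Y u → push f Y w → Walk (_~_ L) (_∉ Y) u w
        connected u w (v , h , fv , r , W) (v' , h' , fv' , r' , W') =
          Walk-reverse (sym~ L) W ++ᵂ (transfer-walk ∉-preimage (C.connected v v' fv fv') r r' ++ᵂ W')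

        closed : ∀ u w → push f Y u → _~_ L u w → w ∉ Y → push f Y w
        closed u w (v , h , fv , r , W) e w∉ = v , h , fv , r , Walk-snoc W e w∉

    push-antitone : ∀ {Y Y'} → Y ⊆L Y' → ∀ {h} → push f Y' h → push f Y h
    push-antitone s (v , h , fv , r , W) =
      v , h , antitone (preimage-mono s) fv , r , Walk-map (λ h∉ h∈ → h∉ (s _ h∈)) id W

    push-isDirection : IsDirection L (push f)
    push-isDirection = push-component , λ Y Y' s h → push-antitone s

  induced-unique : ∀ {f g g'} → IsDirection K f → IsDirection L g → IsDirection L g' →
    Induces f g → Induces f g' → _≈Dir_ {L} g g'
  induced-unique {f} {g} {g'} df dg dg' i i' Y with Direction.Part.nonempty {K} {f} df (preimage Y)
  ... | v , fv with total v
  ... | h , r = component-unique {L} {Y} {g Y} {g' Y} (proj₁ dg Y) (proj₁ dg' Y)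
                  (i Y v h fv r) (i' Y v h fv r)

record IsCorrespondence (K L : Graph) (R : V K → V L → Set) : Set where
  field
    forth : IsConnectedRelation K L R
    back  : IsConnectedRelation L K (flip R)

reverse : ∀ {K L R} → IsCorrespondence K L R → IsCorrespondence L K (flip R)
reverse c = record { forth = IsCorrespondence.back c ; back = IsCorrespondence.forth c }

module _ {K L : Graph} {R : V K → V L → Set} (c : IsCorrespondence K L R) where
  private
    module F = ConnectedRelation (IsCorrespondence.forth c)
    module B = ConnectedRelation (IsCorrespondence.back c)

  ⊆-preimage-image : ∀ X → X ⊆L F.preimage (B.preimage X)
  ⊆-preimage-image X x x∈X with IsConnectedRelation.total (IsCorrespondence.forth c) x
  ... | h , r = F.∈-preimage⁺ (B.∈-preimage⁺ x∈X r) r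

  -- For Y the image of X, X ⊆ preimage Y gives f(preimage Y) ⊆ f(X), and a walk in
  -- L - Y from a vertex related to f(preimage Y) to h transfers to one in K - X.
  induces-reverse : ∀ {f g} → IsDirection K f → IsDirection L g → F.Induces f g → B.Induces g f
  induces-reverse {f} {g} df dg i X h v gh r
    with Direction.Part.nonempty {K} {f} df (F.preimage (B.preimage X))
  ... | v₁ , fv₁ with IsConnectedRelation.total (IsCorrespondence.forth c) v₁
  ... | h₁ , r₁ = Fd.Part.closed-walk X fXv₁ (B.transfer-walk B.∉-preimage walk r₁ r)
    where
      module Fd = Direction {K} {f} df
      Y = B.preimage X
      fXv₁ : f X v₁
      fXv₁ = Fd.antitone (⊆-preimage-image X) fv₁
      walk : Walk (_~_ L) (_∉ Y) h₁ h
      walk = Direction.Part.connected {L} {g} dg Y h₁ h (i Y v₁ h₁ fv₁ r₁) gh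

module _ {K L : Graph} {R : V K → V L → Set} (c : IsCorrespondence K L R) where
  private
    module F = ConnectedRelation (IsCorrespondence.forth c)
    module B = ConnectedRelation (IsCorrespondence.back c)

  induced-injective : ∀ {f f' g} → IsDirection K f → IsDirection K f' → IsDirection L g →
    F.Induces f g → F.Induces f' g → _≈Dir_ {K} f f'
  induced-injective df df' dg i i' =
    B.induced-unique dg df df' (induces-reverse c df dg i) (induces-reverse c df' dg i')

  induced-surjective : ∀ {g} → IsDirection L g → Σ (List (V K) → V K → Set) λ f → IsDirection K f × F.Induces f g
  induced-surjective {g} dg =
    B.push g , B.push-isDirection dg ,
    induces-reverse (reverse c) dg (B.push-isDirection dg) (B.push-induces dg)

decomposition-correspondence : {G : Graph} (D : Decomposition G) → IsPointFinite D → IsHonest D →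
  FiniteParts D → ConnectedParts D → IsCorrespondence G (H D) (λ v h → PV D h v)
decomposition-correspondence D pf hon fin cp = record
  { forth = record
    { finite-preimage = fin
    ; total           = coverV D
    ; image-connected = λ v → Hv-conn D v _ _
    ; edge-linked     = λ e → part-of-edge (coverE D _ _ e)
    }
  ; back = record
    { finite-preimage = pf
    ; total           = λ h → proj₁ (cp h)
    ; image-connected = λ h r r' → Walk-map id (λ e → proj₁ (PE-ok D h _ _ e)) (proj₂ (cp h) _ _ r r')
    ; edge-linked     = hon _ _
    }
  }
  where
    part-of-edge : ∀ {u w} → (∃ λ h → PE D h u w) → ∃ λ h → PV D h u × PV D h w
    part-of-edge (h , e) = h , proj₂ (PE-ok D h _ _ e)

lemma3p5 : (G : Graph) (D : Decomposition G) → IsPointFinite D → IsHonest D →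
    (fin : FiniteParts D) → ConnectedParts D →
    -- f ↦ g_f is a well-defined map from directions of G to directions of H ...
    ((f : List (V G) → V G → Set) → IsDirection G f →
      Σ (List (V (H D)) → V (H D) → Set) λ g → IsDirection (H D) g × IsInducedDir D fin f g)
    × ((f : List (V G) → V G → Set) (g g' : List (V (H D)) → V (H D) → Set) →
      IsDirection G f → IsDirection (H D) g → IsDirection (H D) g' →
      IsInducedDir D fin f g → IsInducedDir D fin f g' → _≈Dir_ {H D} g g')
    -- ... which is injective ...
    × ((f f' : List (V G) → V G → Set) (g : List (V (H D)) → V (H D) → Set) →
      IsDirection G f → IsDirection G f' → IsDirection (H D) g →
      IsInducedDir D fin f g → IsInducedDir D fin f' g → _≈Dir_ {G} f f')
    -- ... and surjective.
    × ((g : List (V (H D)) → V (H D) → Set) → IsDirection (H D) g →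
      Σ (List (V G) → V G → Set) λ f → IsDirection G f × IsInducedDir D fin f g)
lemma3p5 G D pf hon fin cp =
    (λ f df → push f , push-isDirection df , push-induces df)
  , (λ f g g' → induced-unique)
  , (λ f f' g → induced-injective c)
  , (λ g → induced-surjective c)
  where
    c = decomposition-correspondence D pf hon fin cp
    open ConnectedRelation (IsCorrespondence.forth c)
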